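{- Let $s\in\{2,10,14,22,26,34,38,46\}$ (so that $\gcd(48,s)=2$). Then each of the following pairs of circulant graphs is a pair of Type-2 isomorphic circulant graphs with respect to $m=2$: (g) $C_{96}(1,s,47)$ and $C_{96}(s,23,25)$; (h) $C_{96}(3,s,45)$ and $C_{96}(s,21,27)$; (i) $C_{96}(5,s,43)$ and $C_{96}(s,19,29)$; (j) $C_{96}(7,s,41)$ and $C_{96}(s,17,31)$; (k) $C_{96}(9,s,39)$ and $C_{96}(s,15,33)$; (l) $C_{96}(11,s,37)$ and $C_{96}(s,13,35)$.
   Context: For an integer $n\ge 2$ and a set $R\subseteq\{1,\dots,\lfloor n/2\rfloor\}$, the circulant graph $C_n(R)$ has vertex set $\{v_0,\dots,v_{n-1}\}$ (indices modulo $n$), and $v_iv_j$ is an edge iff $i-j\equiv \pm r \pmod n$ for some $r\in R$; we write $C_n(a,b,c)$ for $C_n(\{a,b,c\})$, etc. The reflexive modular reduction of a collection of integers reduces each modulo $n$ to $r'\in\{0,\dots,n-1\}$ and then replaces $r'$ by $n-r'$ whenever $r'>n/2$. For $x$ with $\gcd(n,x)=1$, $xR$ denotes the reflexive modular reduction of $\{xr: r\in R\}$. Given $m>1$ and $0\le t\le n/m-1$, the map $\theta_{n,m,t}$ sends the vertex $v_x$ ($x\in\mathbb{Z}_n$, written $x=qm+j$ with $0\le j\le m-1$) to $u_{x+jtm}$ (subscripts modulo $n$, where $u_0,\dots,u_{n-1}$ are the vertices of $K_n$) and an edge $(v_x,v_{x+s})$ to $(\theta_{n,m,t}(v_x),\theta_{n,m,t}(v_{x+s}))$.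 Two circulant graphs $C_n(R)$ and $C_n(S)$ are called Type-2 isomorphic with respect to $m$ if: $R\neq S$ and $|R|=|S|\ge 3$; there is $r\in R\cap S$ with $m\mid\gcd(n,r)$ and $m^3\mid n$; there is $t$ with $1\le t\le n/m-1$ such that $\theta_{n,m,t}$ maps the edge set of $C_n(R)$ exactly onto the edge set of $C_n(S)$ (i.e. $\theta_{n,m,t}(C_n(R))=C_n(S)$); and $S\neq xR$ for every $x$ with $\gcd(x,n)=1$. -}

module Defs where

open import Data.Nat using (ℕ; zero; suc; _+_; _*_; _∸_; _^_; _≤_; _<_; _>_; NonZero)
open import Data.Nat.Properties using (_<?_)
open import Data.Nat.DivMod using (_/_; _%_)
open import Data.Nat.Divisibility using (_∣_)
open import Data.Nat.GCD using (gcd)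
open import Data.Nat.Coprimality using (Coprime)
open import Data.List using (List; map; length)
open import Data.List.Membership.Propositional using (_∈_)
open import Data.List.Relation.Unary.All using (All)
open import Data.List.Relation.Unary.Unique.Propositional using (Unique)
open import Data.Product using (Σ; ∃; ∃-syntax; _×_; _,_)
open import Data.Sum using (_⊎_)
open import Relation.Nullary using (¬_; yes; no)
open import Relation.Binary.PropositionalEquality using (_≡_)
open import Function.Bundles using (_⇔_)

-- A connection set R is a list of natural numbers; as a set it is its
-- collection of members.  Two lists denote the same set iff they have
-- the same members.
SameSet : List ℕ → List ℕ → Set
SameSet R S = ∀ a → (a ∈ R) ⇔ (a ∈ S)

ValidConn : (n : ℕ) → List ℕ → Set
ValidConn n R = All (λ r → 1 ≤ r × r ≤ n / 2) R

-- Vertices of C_n(R) are v_0 … v_{n-1}, represented by i < n.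
-- v_i v_j is an edge iff i - j ≡ ± r (mod n) for some r ∈ R.
Adj : (n : ℕ) → .{{_ : NonZero n}} → List ℕ → ℕ → ℕ → Set
Adj n R i j = ∃[ r ] (r ∈ R × ((j + r) % n ≡ i % n ⊎ (i + r) % n ≡ j % n))

θ : (n m t : ℕ) → .{{_ : NonZero n}} → .{{_ : NonZero m}} → ℕ → ℕ
θ n m t x = (x + (x % m) * t * m) % n

-- θ_{n,m,t} maps the edge set of C_n(R) exactly onto that of C_n(S).
-- Edges are treated as (symmetric) ordered pairs of adjacent vertices.
MapsOnto : (n m t : ℕ) → .{{_ : NonZero n}} → .{{_ : NonZero m}} →
           List ℕ → List ℕ → Set
MapsOnto n m t R S =
  (∀ x y → x < n → y < n → Adj n R x y → Adj n S (θ n m t x) (θ n m t y)) ×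
  (∀ u v → u < n → v < n → Adj n S u v →
     ∃[ x ] ∃[ y ] (x < n × y < n × Adj n R x y ×
                    θ n m t x ≡ u × θ n m t y ≡ v))

reflRed : (n : ℕ) → .{{_ : NonZero n}} → ℕ → ℕ
reflRed n a with n / 2 <? a % n
... | yes _ = n ∸ a % n
... | no  _ = a % n

scale : (n : ℕ) → .{{_ : NonZero n}} → ℕ → List ℕ → List ℕ
scale n x R = map (λ r → reflRed n (x * r)) R

Type2 : (n m : ℕ) → .{{_ : NonZero n}} → .{{_ : NonZero m}} →
        List ℕ → List ℕ → Set
Type2 n m R S =
  2 ≤ n × 1 < m ×
  ValidConn n R × ValidConn n S × Unique R × Unique S ×
  ¬ SameSet R S ×
  length R ≡ length S × 3 ≤ length R ×
  (∃[ r ] (r ∈ R × r ∈ S × m ∣ gcd n r)) × (m ^ 3 ∣ n) ×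
  (∃[ t ] (1 ≤ t × t ≤ n / m ∸ 1 × MapsOnto n m t R S)) ×
  (∀ x → Coprime x n → ¬ SameSet S (scale n x R))

-- θ = θ_{96,2,12} fixes the even vertices and moves every odd vertex by 24.
-- An even jump s therefore survives unchanged, while an edge of odd jump a
-- joins an even and an odd vertex, so its jump becomes a ± 24: the jumps
-- a and 48 − a become 24 − a and 24 + a (up to sign).  θ_{96,2,36} undoes
-- θ, so θ is an isomorphism C₉₆(a, s, 48 − a) ≅ C₉₆(s, 24 − a, 24 + a).
-- Since adjacency in a circulant graph only depends on differences, it
-- suffices to check the edges {x, x + r} for x < n and r a jump, which
-- makes every remaining condition a small finite computation.
module Submission where

open import Defs
open import Data.Nat using (ℕ; _+_; _*_; _∸_; _^_; _≤_; _<_; NonZero)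
open import Data.Nat.Properties using (_≟_; _≤?_; _<?_; allUpTo?)
open import Data.Nat.DivMod using (_/_; _%_; m%n<n; m<n⇒m%n≡m; %-distribˡ-*; m%n%n≡m%n)
open import Data.Nat.Divisibility using (_∣_; _∣?_)
open import Data.Nat.GCD using (gcd)
open import Data.List using (List; _∷_; []; length)
open import Data.List.Properties using (map-cong)
open import Data.List.Membership.Propositional using (_∈_)
open import Data.List.Membership.Propositional.Properties using (Any↔)
open import Data.List.Membership.DecPropositional _≟_ using (_∈?_)
open import Data.List.Relation.Unary.All as All using (All; []; _∷_)
open import Data.List.Relation.Unary.Any using (any?)
open import Data.List.Relation.Unary.Unique.Propositional using (Unique)
open import Data.List.Relation.Unary.Unique.DecPropositional _≟_ using (unique?)
open import Data.Product using (_×_; _,_; ∃-syntax)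
open import Data.Sum using (inj₁; inj₂; swap)
open import Function using (case_of_)
open import Function.Bundles using (Inverse; Equivalence; mk⇔)
open import Relation.Nullary using (¬_; Dec; yes; no; ¬?; contradiction)
open import Relation.Nullary.Decidable using (map′; _×-dec_; _⊎-dec_; from-yes)
open import Relation.Binary.PropositionalEquality
  using (_≡_; sym; trans; cong; subst; module ≡-Reasoning)

sameSet? : (A B : List ℕ) → Dec (SameSet A B)
sameSet? A B =
  map′ (λ (A⊆B , B⊆A) a → mk⇔ (All.lookup A⊆B) (All.lookup B⊆A))
       (λ A≈B → All.tabulate (Equivalence.to (A≈B _)) , All.tabulate (Equivalence.from (A≈B _)))
       (All.all? (_∈? B) A ×-dec All.all? (_∈? A) B)

module _ (n : ℕ) .{{_ : NonZero n}} where

  Adj-sym : ∀ {R i j} → Adj n R i j → Adj n R j i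
  Adj-sym (r , r∈R , e) = r , r∈R , swap e

  adj? : ∀ R i j → Dec (Adj n R i j)
  adj? R i j = map′ (Inverse.from Any↔) (Inverse.to Any↔)
    (any? (λ r → ((j + r) % n ≟ i % n) ⊎-dec ((i + r) % n ≟ j % n)) R)

  PreservesJumpEdges : (ℕ → ℕ) → List ℕ → List ℕ → Set
  PreservesJumpEdges f R S =
    ∀ {x} → x < n → All (λ r → Adj n S (f x) (f ((x + r) % n))) R

  preservesJumpEdges? : ∀ f R S → Dec (PreservesJumpEdges f R S)
  preservesJumpEdges? f R S =
    allUpTo? (λ x → All.all? (λ r → adj? S (f x) (f ((x + r) % n))) R) n

  preservesAdj : ∀ {f R S} → PreservesJumpEdges f R S →
                 ∀ {x y} → x < n → y < n → Adj n R x y → Adj n S (f x) (f y)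
  preservesAdj {f} {R} {S} jumps {x} {y} x<n y<n (r , r∈R , inj₂ x+r≡y) =
    subst (λ z → Adj n S (f x) (f z)) (trans x+r≡y (m<n⇒m%n≡m y<n))
          (All.lookup (jumps x<n) r∈R)
  preservesAdj {f} {R} {S} jumps {x} {y} x<n y<n (r , r∈R , inj₁ y+r≡x) =
    Adj-sym (subst (λ z → Adj n S (f y) (f z)) (trans y+r≡x (m<n⇒m%n≡m x<n))
                   (All.lookup (jumps y<n) r∈R))

  RightInverseOn : (ℕ → ℕ) → (ℕ → ℕ) → Set
  RightInverseOn f g = ∀ {u} → u < n → f (g u) ≡ u

  rightInverseOn? : ∀ f g → Dec (RightInverseOn f g)
  rightInverseOn? f g = allUpTo? (λ u → f (g u) ≟ u) n

  sharedJump? : ∀ m R S → Dec (∃[ r ] (r ∈ R × r ∈ S × m ∣ gcd n r))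
  sharedJump? m R S = map′ (Inverse.from Any↔) (Inverse.to Any↔)
    (any? (λ r → r ∈? S ×-dec m ∣? gcd n r) R)

  reflRed-cong : ∀ {a b} → a % n ≡ b % n → reflRed n a ≡ reflRed n b
  reflRed-cong {a} {b} eq with n / 2 <? a % n | n / 2 <? b % n
  ... | yes _ | yes _  = cong (n ∸_) eq
  ... | no _  | no _   = eq
  ... | yes p | no ¬p  = contradiction (subst (n / 2 <_) eq p) ¬p
  ... | no ¬p | yes p  = contradiction (subst (n / 2 <_) (sym eq) p) ¬p

  scale-% : ∀ x R → scale n x R ≡ scale n (x % n) R
  scale-% x = map-cong λ r → reflRed-cong (begin
    x * r % n                 ≡⟨ %-distribˡ-* x r n ⟩
    x % n * (r % n) % n       ≡⟨ cong (λ z → z * (r % n) % n) (sym (m%n%n≡m%n x n)) ⟩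
    x % n % n * (r % n) % n   ≡⟨ sym (%-distribˡ-* (x % n) r n) ⟩
    x % n * r % n             ∎)
    where open ≡-Reasoning

  NoMultiplierBelow : List ℕ → List ℕ → Set
  NoMultiplierBelow R S = ∀ {x} → x < n → ¬ SameSet S (scale n x R)

  noMultiplierBelow? : ∀ R S → Dec (NoMultiplierBelow R S)
  noMultiplierBelow? R S = allUpTo? (λ x → ¬? (sameSet? S (scale n x R))) n

  noMultiplier : ∀ {R S} → NoMultiplierBelow R S → ∀ x → ¬ SameSet S (scale n x R)
  noMultiplier {R} {S} none x =
    subst (λ L → ¬ SameSet S L) (sym (scale-% x R)) (none (m%n<n x n))

module _ (n m : ℕ) .{{_ : NonZero n}} .{{_ : NonZero m}} where

  mapsOnto-viaInverse : ∀ {t t′ R S} →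
    PreservesJumpEdges n (θ n m t) R S → PreservesJumpEdges n (θ n m t′) S R →
    RightInverseOn n (θ n m t) (θ n m t′) → MapsOnto n m t R S
  mapsOnto-viaInverse {t} {t′} fwd bwd inv =
    (λ x y x<n y<n → preservesAdj n fwd x<n y<n) ,
    (λ u v u<n v<n uv → θ n m t′ u , θ n m t′ v , m%n<n _ n , m%n<n _ n ,
                        preservesAdj n bwd u<n v<n uv , inv u<n , inv v<n)

  -- A decidable strengthening of Type2: t is fixed, surjectivity of θ_{n,m,t}
  -- is witnessed by an inverse θ_{n,m,t′}, and every multiplier x < n is
  -- excluded, coprime to n or not.
  Type2Certificate : (t t′ : ℕ) → List ℕ → List ℕ → Set
  Type2Certificate t t′ R S =
    2 ≤ n × 1 < m ×
    ValidConn n R × ValidConn n S × Unique R × Unique S ×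
    ¬ SameSet R S ×
    length R ≡ length S × 3 ≤ length R ×
    (∃[ r ] (r ∈ R × r ∈ S × m ∣ gcd n r)) × (m ^ 3 ∣ n) ×
    1 ≤ t × t ≤ n / m ∸ 1 ×
    PreservesJumpEdges n (θ n m t) R S × PreservesJumpEdges n (θ n m t′) S R ×
    RightInverseOn n (θ n m t) (θ n m t′) ×
    NoMultiplierBelow n R S

  type2Certificate? : ∀ t t′ R S → Dec (Type2Certificate t t′ R S)
  type2Certificate? t t′ R S =
    2 ≤? n ×-dec 1 <? m ×-dec
    validConn? R ×-dec validConn? S ×-dec unique? R ×-dec unique? S ×-dec
    ¬? (sameSet? R S) ×-dec
    length R ≟ length S ×-dec 3 ≤? length R ×-dec
    sharedJump? n m R S ×-dec m ^ 3 ∣? n ×-dec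
    1 ≤? t ×-dec t ≤? n / m ∸ 1 ×-dec
    preservesJumpEdges? n (θ n m t) R S ×-dec preservesJumpEdges? n (θ n m t′) S R ×-dec
    rightInverseOn? n (θ n m t) (θ n m t′) ×-dec
    noMultiplierBelow? n R S
    where
    validConn? : ∀ R → Dec (ValidConn n R)
    validConn? = All.all? (λ r → 1 ≤? r ×-dec r ≤? n / 2)

  certificate⇒Type2 : ∀ {t t′ R S} → Type2Certificate t t′ R S → Type2 n m R S
  certificate⇒Type2 {t}
    (2≤n , 1<m , validR , validS , uniqueR , uniqueS , R≉S , |R|≡|S| , 3≤|R| ,
     shared , m³∣n , 1≤t , t≤ , fwd , bwd , inv , noMult) =
    2≤n , 1<m , validR , validS , uniqueR , uniqueS , R≉S , |R|≡|S| , 3≤|R| ,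
    shared , m³∣n , (t , 1≤t , t≤ , mapsOnto-viaInverse fwd bwd inv) ,
    λ x _ → noMultiplier n noMult x

Family : ℕ → ℕ → Set
Family s a = Type2Certificate 96 2 12 36 (a ∷ s ∷ 48 ∸ a ∷ []) (s ∷ 24 ∸ a ∷ 24 + a ∷ [])

family⇒Type2 : ∀ {s a} → Family s a →
  Type2 96 2 (a ∷ s ∷ 48 ∸ a ∷ []) (s ∷ 24 ∸ a ∷ 24 + a ∷ [])
family⇒Type2 = certificate⇒Type2 96 2

evenJumps oddJumps : List ℕ
evenJumps = 2 ∷ 10 ∷ 14 ∷ 22 ∷ 26 ∷ 34 ∷ 38 ∷ 46 ∷ []
oddJumps  = 1 ∷ 3 ∷ 5 ∷ 7 ∷ 9 ∷ 11 ∷ []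

certificates : All (λ s → All (Family s) oddJumps) evenJumps
certificates = from-yes (All.all? (λ s → All.all? (λ a →
  type2Certificate? 96 2 12 36 (a ∷ s ∷ 48 ∸ a ∷ []) (s ∷ 24 ∸ a ∷ 24 + a ∷ [])) oddJumps) evenJumps)

mainTheorem4 : (s : ℕ) → s ∈ (2 ∷ 10 ∷ 14 ∷ 22 ∷ 26 ∷ 34 ∷ 38 ∷ 46 ∷ []) →
    Type2 96 2 (1 ∷ s ∷ 47 ∷ []) (s ∷ 23 ∷ 25 ∷ []) ×
    Type2 96 2 (3 ∷ s ∷ 45 ∷ []) (s ∷ 21 ∷ 27 ∷ []) ×
    Type2 96 2 (5 ∷ s ∷ 43 ∷ []) (s ∷ 19 ∷ 29 ∷ []) ×
    Type2 96 2 (7 ∷ s ∷ 41 ∷ []) (s ∷ 17 ∷ 31 ∷ []) ×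
    Type2 96 2 (9 ∷ s ∷ 39 ∷ []) (s ∷ 15 ∷ 33 ∷ []) ×
    Type2 96 2 (11 ∷ s ∷ 37 ∷ []) (s ∷ 13 ∷ 35 ∷ [])
mainTheorem4 s s∈ = case All.lookup certificates s∈ of λ where
  (g ∷ h ∷ i ∷ j ∷ k ∷ l ∷ []) → family⇒Type2 g , family⇒Type2 h , family⇒Type2 i ,
                                  family⇒Type2 j , family⇒Type2 k , family⇒Type2 l
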